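{- For an odd integer $m\ge3$ and an integer $0\le j\le m-2$, let $$R_m^{(j)}(x,y)=-\frac{m-2-2j}{m-2}x^{m-2}+(-1)^jx^{m-2-j}y^j+(-1)^jx^jy^{m-2-j}-\frac{m-2-2j}{m-2}y^{m-2}.$$ Let $k=2K+1\ge5$ be an odd integer and $0\le i\le k-2$. Then $$\frac{\partial^2}{\partial y^2}\Big(R_k^{(i)}(x-y,y)\Big)=(k-2-i)(k-3-i)R_{k-2}^{(i)}(x-y,y)-2i(k-2-i)R_{k-2}^{(k-3-i)}(x-y,y)+i(i-1)R_{k-2}^{(i-2)}(x-y,y),$$ where any term on the right whose superscript lies outside $\{0,1,\dots,k-4\}$ is omitted (its coefficient is zero).
   Context: All expressions are polynomials in $x,y$ with rational coefficients. -}

module Defs where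

open import Data.Nat as ℕ using (ℕ; zero; suc; _∸_)
open import Data.Integer as ℤ using (ℤ; +_)
open import Data.Rational as ℚ using (ℚ; 0ℚ; 1ℚ)
open import Data.Bool using (Bool; true; false; _∧_; if_then_else_)
open import Relation.Nullary.Decidable using (⌊_⌋)

data Poly : Set where
  con  : ℚ → Poly
  X    : Poly
  Y    : Poly
  _⊕_  : Poly → Poly → Poly
  _⊗_  : Poly → Poly → Poly
  _^^_ : Poly → ℕ → Poly

infixl 6 _⊕_
infixl 7 _⊗_
infixr 8 _^^_

powℚ : ℚ → ℕ → ℚ
powℚ a zero    = 1ℚ
powℚ a (suc n) = a ℚ.* powℚ a n

⟦_⟧ : Poly → ℚ → ℚ → ℚ
⟦ con c ⟧  a b = c
⟦ X ⟧      a b = a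
⟦ Y ⟧      a b = b
⟦ p ⊕ q ⟧  a b = ⟦ p ⟧ a b ℚ.+ ⟦ q ⟧ a b
⟦ p ⊗ q ⟧  a b = ⟦ p ⟧ a b ℚ.* ⟦ q ⟧ a b
⟦ p ^^ n ⟧ a b = powℚ (⟦ p ⟧ a b) n

-- Two polynomials over ℚ are equal iff they agree as functions on ℚ²
-- (ℚ is infinite).
_≈ₚ_ : Poly → Poly → Set
p ≈ₚ q = ∀ a b → ⟦ p ⟧ a b ≡ ⟦ q ⟧ a b
  where open import Relation.Binary.PropositionalEquality using (_≡_)

ℕtoℚ : ℕ → ℚ
ℕtoℚ n = + n ℚ./ 1

ℤtoℚ : ℤ → ℚ
ℤtoℚ z = z ℚ./ 1

∂y : Poly → Poly
∂y (con c)      = con 0ℚ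
∂y X            = con 0ℚ
∂y Y            = con 1ℚ
∂y (p ⊕ q)      = ∂y p ⊕ ∂y q
∂y (p ⊗ q)      = ∂y p ⊗ q ⊕ p ⊗ ∂y q
∂y (p ^^ zero)  = con 0ℚ
∂y (p ^^ suc n) = con (ℕtoℚ (suc n)) ⊗ p ^^ n ⊗ ∂y p

substP : Poly → Poly → Poly → Poly
substP (con c)  s t = con c
substP X        s t = s
substP Y        s t = t
substP (p ⊕ q)  s t = substP p s t ⊕ substP q s t
substP (p ⊗ q)  s t = substP p s t ⊗ substP q s t
substP (p ^^ n) s t = substP p s t ^^ n

atXminusY : Poly → Poly
atXminusY p = substP p (X ⊕ con (ℚ.- 1ℚ) ⊗ Y) Y

sgn : ℕ → ℚ
sgn zero    = 1ℚ
sgn (suc j) = ℚ.- sgn j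

-- the coefficient (m-2-2j)/(m-2); only used with m ≥ 3 (so m-2 ≥ 1);
-- for m ≤ 2 it is set to 0 (irrelevant).
coefR : ℕ → ℕ → ℚ
coefR m j with m ∸ 2
... | zero  = 0ℚ
... | suc d = (+ suc d ℤ.- + (2 ℕ.* j)) ℚ./ suc d

R : ℕ → ℕ → Poly
R m j =   con (ℚ.- coefR m j) ⊗ X ^^ (m ∸ 2)
        ⊕ con (sgn j) ⊗ X ^^ (m ∸ 2 ∸ j) ⊗ Y ^^ j
        ⊕ con (sgn j) ⊗ X ^^ j ⊗ Y ^^ (m ∸ 2 ∸ j)
        ⊕ con (ℚ.- coefR m j) ⊗ Y ^^ (m ∸ 2)

termR : ℤ → ℕ → ℤ → Poly
termR c m j =
  if ⌊ + 0 ℤ.≤? j ⌋ ∧ ⌊ j ℤ.≤? + (m ∸ 2) ⌋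
  then con (ℤtoℚ c) ⊗ atXminusY (R m (ℤ.∣ j ∣))
  else con 0ℚ

-- Write u = x − y, so that ∂y u = −1, and n = k − 2 = i + p. For a monomial
--   ∂y² (u^a y^b) = a(a−1) u^(a−2) y^b − 2ab u^(a−1) y^(b−1) + b(b−1) u^a y^(b−2).
-- R_k^(i)(u,y) is −c_k(i)(u^n + y^n) plus (−1)^i times the symmetric pair u^p y^i + u^i y^p,
-- where c_m(j) = (m−2−2j)/(m−2). Differentiating the pair yields p(p−1), −2ip and i(i−1)
-- times the symmetric pairs of R_n^(i), R_n^(p−1) and R_n^(i−2); the signs agree because
-- i + p is odd. The pure powers yield −c_k(i) n(n−1)(u^(n−2) + y^(n−2)), and matching them needs
--   p(p−1) c_n(i) − 2ip c_n(p−1) + i(i−1) c_n(i−2) = n(n−1) c_k(i),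
-- a polynomial identity in i and p once the denominators n and n − 2 are cleared.
-- A superscript leaves {0, …, n−2} only when its coefficient vanishes.

module Submission where

open import Defs
open import Data.Bool using (true; false; _∧_)
open import Data.Nat as ℕ using (ℕ; zero; suc; _∸_; _≤_; z≤n; s≤s)
import Data.Nat.Properties as ℕ
open import Data.Nat.Tactic.RingSolver using () renaming (solve-∀ to solveℕ)
open import Data.Integer as ℤ using (+_)
import Data.Integer.Properties as ℤ
open import Data.Integer.Tactic.RingSolver using () renaming (solve-∀ to solveℤ)
open import Data.Product using (_×_; _,_)
open import Data.Rational using (ℚ; 0ℚ; 1ℚ; toℚᵘ; fromℚᵘ)
open import Data.Rational.Properties
  using ( _≟_; +-*-commutativeRing; toℚᵘ-injective; toℚᵘ-fromℚᵘ; fromℚᵘ-cong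
        ; toℚᵘ-homo-+; toℚᵘ-homo-*; toℚᵘ-homo‿-; neg-distribˡ-*
        ; +-comm; *-assoc; *-zeroˡ; *-identityˡ; *-identityʳ)
import Data.Rational.Unnormalised.Base as ℚᵘ
import Data.Rational.Unnormalised.Properties as ℚᵘₚ
open import Data.Sum using (_⊎_; inj₁; inj₂)
open import Level using (0ℓ)
open import Relation.Binary.PropositionalEquality
open import Relation.Nullary.Decidable using (⌊_⌋; yes; no; dec⇒maybe)
open import Relation.Nullary.Negation using (contradiction)
open import Tactic.RingSolver using (solve-∀)
import Tactic.RingSolver.Core.AlmostCommutativeRing as ACR

ℚ-ring : ACR.AlmostCommutativeRing 0ℓ 0ℓ
ℚ-ring = ACR.fromCommutativeRing +-*-commutativeRing (λ x → dec⇒maybe (0ℚ ≟ x))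

∂²R-expansion : ℕ → ℕ → Poly
∂²R-expansion k i =
    termR ((+ k ℤ.- + 2 ℤ.- + i) ℤ.* (+ k ℤ.- + 3 ℤ.- + i)) (k ∸ 2) (+ i)
  ⊕ termR (ℤ.- (+ 2 ℤ.* + i ℤ.* (+ k ℤ.- + 2 ℤ.- + i))) (k ∸ 2) (+ k ℤ.- + 3 ℤ.- + i)
  ⊕ termR (+ i ℤ.* (+ i ℤ.- + 1)) (k ∸ 2) (+ i ℤ.- + 2)

module _ where
  open import Data.Rational using (_+_; _*_; -_; _-_; _/_)

  private
    module Unnormalised where
      open ℚᵘₚ.≃-Reasoning
      open ℚᵘₚ using (≃-sym)

      fromℚᵘ-homo-+ : ∀ p q → fromℚᵘ (p ℚᵘ.+ q) ≡ fromℚᵘ p + fromℚᵘ q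
      fromℚᵘ-homo-+ p q = toℚᵘ-injective (begin
        toℚᵘ (fromℚᵘ (p ℚᵘ.+ q))              ≈⟨ toℚᵘ-fromℚᵘ (p ℚᵘ.+ q) ⟩
        p ℚᵘ.+ q                              ≈⟨ ℚᵘₚ.+-cong (≃-sym (toℚᵘ-fromℚᵘ p)) (≃-sym (toℚᵘ-fromℚᵘ q)) ⟩
        toℚᵘ (fromℚᵘ p) ℚᵘ.+ toℚᵘ (fromℚᵘ q)  ≈⟨ toℚᵘ-homo-+ (fromℚᵘ p) (fromℚᵘ q) ⟨
        toℚᵘ (fromℚᵘ p + fromℚᵘ q)            ∎)

      fromℚᵘ-homo-* : ∀ p q → fromℚᵘ (p ℚᵘ.* q) ≡ fromℚᵘ p * fromℚᵘ q
      fromℚᵘ-homo-* p q = toℚᵘ-injective (begin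
        toℚᵘ (fromℚᵘ (p ℚᵘ.* q))              ≈⟨ toℚᵘ-fromℚᵘ (p ℚᵘ.* q) ⟩
        p ℚᵘ.* q                              ≈⟨ ℚᵘₚ.*-cong (≃-sym (toℚᵘ-fromℚᵘ p)) (≃-sym (toℚᵘ-fromℚᵘ q)) ⟩
        toℚᵘ (fromℚᵘ p) ℚᵘ.* toℚᵘ (fromℚᵘ q)  ≈⟨ toℚᵘ-homo-* (fromℚᵘ p) (fromℚᵘ q) ⟨
        toℚᵘ (fromℚᵘ p * fromℚᵘ q)            ∎)

      fromℚᵘ-homo‿- : ∀ p → fromℚᵘ (ℚᵘ.- p) ≡ - fromℚᵘ p
      fromℚᵘ-homo‿- p = toℚᵘ-injective (begin
        toℚᵘ (fromℚᵘ (ℚᵘ.- p))  ≈⟨ toℚᵘ-fromℚᵘ (ℚᵘ.- p) ⟩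
        ℚᵘ.- p                  ≈⟨ ℚᵘₚ.-‿cong (≃-sym (toℚᵘ-fromℚᵘ p)) ⟩
        ℚᵘ.- toℚᵘ (fromℚᵘ p)    ≈⟨ toℚᵘ-homo‿- (fromℚᵘ p) ⟨
        toℚᵘ (- fromℚᵘ p)       ∎)

    open Unnormalised

  open ≡-Reasoning

  ℤtoℚ-homo-+ : ∀ a b → ℤtoℚ (a ℤ.+ b) ≡ ℤtoℚ a + ℤtoℚ b
  ℤtoℚ-homo-+ a b = trans (fromℚᵘ-cong {ℚᵘ.mkℚᵘ (a ℤ.+ b) 0} {ℚᵘ.mkℚᵘ a 0 ℚᵘ.+ ℚᵘ.mkℚᵘ b 0} (ℚᵘ.*≡* (units a b)))
                     (fromℚᵘ-homo-+ (ℚᵘ.mkℚᵘ a 0) (ℚᵘ.mkℚᵘ b 0))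
    where
    units : ∀ a b → (a ℤ.+ b) ℤ.* + 1 ≡ (a ℤ.* + 1 ℤ.+ b ℤ.* + 1) ℤ.* + 1
    units = solveℤ

  ℤtoℚ-homo-* : ∀ a b → ℤtoℚ (a ℤ.* b) ≡ ℤtoℚ a * ℤtoℚ b
  ℤtoℚ-homo-* a b = fromℚᵘ-homo-* (ℚᵘ.mkℚᵘ a 0) (ℚᵘ.mkℚᵘ b 0)

  ℤtoℚ-homo‿- : ∀ a → ℤtoℚ (ℤ.- a) ≡ - ℤtoℚ a
  ℤtoℚ-homo‿- a = fromℚᵘ-homo‿- (ℚᵘ.mkℚᵘ a 0)

  ℤtoℚ-homo-sub : ∀ a b → ℤtoℚ (a ℤ.- b) ≡ ℤtoℚ a - ℤtoℚ b
  ℤtoℚ-homo-sub a b = trans (ℤtoℚ-homo-+ a (ℤ.- b)) (cong (λ q → ℤtoℚ a + q) (ℤtoℚ-homo‿- b))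

  ℕtoℚ-homo-+ : ∀ m n → ℕtoℚ (m ℕ.+ n) ≡ ℕtoℚ m + ℕtoℚ n
  ℕtoℚ-homo-+ m n = ℤtoℚ-homo-+ (+ m) (+ n)

  ℕtoℚ-homo-* : ∀ m n → ℕtoℚ (m ℕ.* n) ≡ ℕtoℚ m * ℕtoℚ n
  ℕtoℚ-homo-* m n = trans (cong ℤtoℚ (ℤ.pos-* m n)) (ℤtoℚ-homo-* (+ m) (+ n))

  ℕtoℚ-∸ : ∀ {m n} → n ≤ m → ℕtoℚ (m ∸ n) ≡ ℕtoℚ m - ℕtoℚ n
  ℕtoℚ-∸ {m} {n} n≤m = begin
    ℕtoℚ (m ∸ n)                  ≡⟨ add-sub (ℕtoℚ (m ∸ n)) (ℕtoℚ n) ⟩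
    ℕtoℚ n + ℕtoℚ (m ∸ n) - ℕtoℚ n  ≡⟨ cong (_- ℕtoℚ n) (ℕtoℚ-homo-+ n (m ∸ n)) ⟨
    ℕtoℚ (n ℕ.+ (m ∸ n)) - ℕtoℚ n   ≡⟨ cong (λ k → ℕtoℚ k - ℕtoℚ n) (ℕ.m+[n∸m]≡n n≤m) ⟩
    ℕtoℚ m - ℕtoℚ n               ∎
    where
    add-sub : ∀ a b → a ≡ b + a - b
    add-sub = solve-∀ ℚ-ring

  falling₂ : ℕ → ℚ
  falling₂ a = ℕtoℚ a * (ℕtoℚ a - 1ℚ)

  ℤtoℚ-falling₂ : ∀ a → ℤtoℚ (+ a ℤ.* (+ a ℤ.- + 1)) ≡ falling₂ a
  ℤtoℚ-falling₂ a = trans (ℤtoℚ-homo-* (+ a) (+ a ℤ.- + 1)) (cong (ℕtoℚ a *_) (ℤtoℚ-homo-sub (+ a) (+ 1)))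

  /-as-* : ∀ z d → z / suc d ≡ ℤtoℚ z * (+ 1 / suc d)
  /-as-* z d = trans (fromℚᵘ-cong {ℚᵘ.mkℚᵘ z d} {ℚᵘ.mkℚᵘ z 0 ℚᵘ.* ℚᵘ.mkℚᵘ (+ 1) d} (ℚᵘ.*≡* denominators))
                     (fromℚᵘ-homo-* (ℚᵘ.mkℚᵘ z 0) (ℚᵘ.mkℚᵘ (+ 1) d))
    where
    denominators : z ℤ.* + (1 ℕ.* suc d) ≡ (z ℤ.* + 1) ℤ.* + suc d
    denominators = trans (cong (λ n → z ℤ.* + n) (ℕ.*-identityˡ (suc d)))
                         (cong (ℤ._* + suc d) (sym (ℤ.*-identityʳ z)))

  ℕtoℚ-*-inverse : ∀ d → ℕtoℚ (suc d) * (+ 1 / suc d) ≡ 1ℚ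
  ℕtoℚ-*-inverse d = trans (sym (/-as-* (+ suc d) d)) (fromℚᵘ-cong {ℚᵘ.mkℚᵘ (+ suc d) d} {ℚᵘ.mkℚᵘ (+ 1) 0} (ℚᵘ.*≡* (ℤ.*-comm (+ suc d) (+ 1))))

  sgn-+ : ∀ m n → sgn (m ℕ.+ n) ≡ sgn m * sgn n
  sgn-+ zero    n = sym (*-identityˡ (sgn n))
  sgn-+ (suc m) n = trans (cong -_ (sgn-+ m n)) (neg-distribˡ-* (sgn m) (sgn n))

  sgn-*-self : ∀ m → sgn m * sgn m ≡ 1ℚ
  sgn-*-self zero    = refl
  sgn-*-self (suc m) = trans (neg-square (sgn m)) (sgn-*-self m)
    where
    neg-square : ∀ a → - a * - a ≡ a * a
    neg-square = solve-∀ ℚ-ring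

  sgn-2+ : ∀ m → sgn (2 ℕ.+ m) ≡ sgn m
  sgn-2+ m = neg-neg (sgn m)
    where
    neg-neg : ∀ a → - - a ≡ a
    neg-neg = solve-∀ ℚ-ring

  sgn-even-sum : ∀ m n t → m ℕ.+ n ≡ 2 ℕ.* t → sgn m ≡ sgn n
  sgn-even-sum m n t m+n≡2t = begin
    sgn m                      ≡⟨ *-identityʳ (sgn m) ⟨
    sgn m * 1ℚ                 ≡⟨ cong (sgn m *_) (sgn-*-self n) ⟨
    sgn m * (sgn n * sgn n)    ≡⟨ *-assoc (sgn m) (sgn n) (sgn n) ⟨
    sgn m * sgn n * sgn n      ≡⟨ cong (_* sgn n) (sgn-+ m n) ⟨
    sgn (m ℕ.+ n) * sgn n      ≡⟨ cong (λ k → sgn k * sgn n) m+n≡2t ⟩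
    sgn (2 ℕ.* t) * sgn n      ≡⟨ cong (_* sgn n) sgn-2*t ⟩
    1ℚ * sgn n                 ≡⟨ *-identityˡ (sgn n) ⟩
    sgn n                      ∎
    where
    sgn-2*t : sgn (2 ℕ.* t) ≡ 1ℚ
    sgn-2*t = trans (cong (λ k → sgn (t ℕ.+ k)) (ℕ.+-identityʳ t)) (trans (sgn-+ t t) (sgn-*-self t))

  coefR-unfold : ∀ m j {d} → m ∸ 2 ≡ suc d → coefR m j ≡ (ℕtoℚ (m ∸ 2) - ℕtoℚ 2 * ℕtoℚ j) * (+ 1 / suc d)
  coefR-unfold m j {d} m∸2≡ with m ∸ 2
  coefR-unfold m j {d} refl | .(suc d) = begin
    (+ suc d ℤ.- + (2 ℕ.* j)) / suc d                       ≡⟨ /-as-* (+ suc d ℤ.- + (2 ℕ.* j)) d ⟩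
    ℤtoℚ (+ suc d ℤ.- + (2 ℕ.* j)) * (+ 1 / suc d)          ≡⟨ cong (_* (+ 1 / suc d)) (ℤtoℚ-homo-sub (+ suc d) (+ (2 ℕ.* j))) ⟩
    (ℕtoℚ (suc d) - ℕtoℚ (2 ℕ.* j)) * (+ 1 / suc d)         ≡⟨ cong (λ q → (ℕtoℚ (suc d) - q) * (+ 1 / suc d)) (ℕtoℚ-homo-* 2 j) ⟩
    (ℕtoℚ (suc d) - ℕtoℚ 2 * ℕtoℚ j) * (+ 1 / suc d)        ∎

  -- An index such as p ∸ 1 or i ∸ 2 is a junk value exactly when the coefficient in front
  -- of it vanishes, so it may be rewritten under that coefficient as if no truncation occurred.
  *-cong-when-positive : ∀ k a b {x y} → (1 ≤ a → 1 ≤ b → x ≡ y) →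
                         k * ℕtoℚ a * ℕtoℚ b * x ≡ k * ℕtoℚ a * ℕtoℚ b * y
  *-cong-when-positive k zero    b       {x} {y} _   = zero-left k (ℕtoℚ b) x y
    where
    zero-left : ∀ k b x y → k * 0ℚ * b * x ≡ k * 0ℚ * b * y
    zero-left = solve-∀ ℚ-ring
  *-cong-when-positive k (suc a) zero    {x} {y} _   = zero-right k (ℕtoℚ (suc a)) x y
    where
    zero-right : ∀ k a x y → k * a * 0ℚ * x ≡ k * a * 0ℚ * y
    zero-right = solve-∀ ℚ-ring
  *-cong-when-positive k (suc a) (suc b) x≡y = cong (k * ℕtoℚ (suc a) * ℕtoℚ (suc b) *_) (x≡y (s≤s z≤n) (s≤s z≤n))

  falling₂-*-cong : ∀ a {x y} → (2 ≤ a → x ≡ y) → falling₂ a * x ≡ falling₂ a * y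
  falling₂-*-cong zero          {x} {y} _   = trans (*-zeroˡ x) (sym (*-zeroˡ y))
  falling₂-*-cong (suc zero)    {x} {y} _   = trans (*-zeroˡ x) (sym (*-zeroˡ y))
  falling₂-*-cong (suc (suc a)) x≡y = cong (falling₂ (suc (suc a)) *_) (x≡y (s≤s (s≤s z≤n)))

  -- I = i, P = p, w = 1/(n − 2), w′ = 1/n; both sides equal (p − i)(n − 1).
  coefficient-identity : ∀ I P w w′ → (I + P - ℕtoℚ 2) * w ≡ 1ℚ → (I + P) * w′ ≡ 1ℚ →
      P * (P - 1ℚ) * ((I + P - ℕtoℚ 2 - ℕtoℚ 2 * I) * w)
    + - ℕtoℚ 2 * I * P * ((I + P - ℕtoℚ 2 - ℕtoℚ 2 * (P - 1ℚ)) * w)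
    + I * (I - 1ℚ) * ((I + P - ℕtoℚ 2 - ℕtoℚ 2 * (I - ℕtoℚ 2)) * w)
    ≡ (I + P - ℕtoℚ 2 * I) * w′ * ((I + P) * (I + P - 1ℚ))
  coefficient-identity I P w w′ hw hw′ = begin
    _                                                ≡⟨ factor I P w ⟩
    (P - I) * (I + P - 1ℚ) * ((I + P - ℕtoℚ 2) * w)  ≡⟨ cong ((P - I) * (I + P - 1ℚ) *_) (trans hw (sym hw′)) ⟩
    (P - I) * (I + P - 1ℚ) * ((I + P) * w′)          ≡⟨ unfactor I P w′ ⟩
    _                                                ∎
    where
    factor : ∀ I P w →
        P * (P - 1ℚ) * ((I + P - ℕtoℚ 2 - ℕtoℚ 2 * I) * w)
      + - ℕtoℚ 2 * I * P * ((I + P - ℕtoℚ 2 - ℕtoℚ 2 * (P - 1ℚ)) * w)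
      + I * (I - 1ℚ) * ((I + P - ℕtoℚ 2 - ℕtoℚ 2 * (I - ℕtoℚ 2)) * w)
      ≡ (P - I) * (I + P - 1ℚ) * ((I + P - ℕtoℚ 2) * w)
    factor = solve-∀ ℚ-ring
    unfactor : ∀ I P w′ → (P - I) * (I + P - 1ℚ) * ((I + P) * w′) ≡ (I + P - ℕtoℚ 2 * I) * w′ * ((I + P) * (I + P - 1ℚ))
    unfactor = solve-∀ ℚ-ring

  coefR-recurrence : ∀ t i p → i ℕ.+ p ≡ 3 ℕ.+ 2 ℕ.* t →
      falling₂ p * coefR (i ℕ.+ p) i
    + - ℕtoℚ 2 * ℕtoℚ i * ℕtoℚ p * coefR (i ℕ.+ p) (p ∸ 1)
    + falling₂ i * coefR (i ℕ.+ p) (i ∸ 2)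
    ≡ coefR (2 ℕ.+ (i ℕ.+ p)) i * falling₂ (i ℕ.+ p)
  coefR-recurrence t i p n≡ = begin
      falling₂ p * coefR n i + - ℕtoℚ 2 * I * P * coefR n (p ∸ 1) + falling₂ i * coefR n (i ∸ 2)
        ≡⟨ cong₂ _+_ (cong₂ _+_ (cong (falling₂ p *_) (coefR-n i)) coefR-n[p∸1]) coefR-n[i∸2] ⟩
      P * (P - 1ℚ) * ((I + P - ℕtoℚ 2 - ℕtoℚ 2 * I) * w)
    + - ℕtoℚ 2 * I * P * ((I + P - ℕtoℚ 2 - ℕtoℚ 2 * (P - 1ℚ)) * w)
    + I * (I - 1ℚ) * ((I + P - ℕtoℚ 2 - ℕtoℚ 2 * (I - ℕtoℚ 2)) * w)
        ≡⟨ coefficient-identity I P w w′ (inverse (2 ℕ.* t) n∸2≡ N[n∸2]) (inverse (2 ℕ.+ 2 ℕ.* t) n≡ N[n]) ⟩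
      (I + P - ℕtoℚ 2 * I) * w′ * ((I + P) * (I + P - 1ℚ))
        ≡⟨ cong₂ _*_ coefR-2+n (cong (λ ν → ν * (ν - 1ℚ)) N[n]) ⟨
      coefR (2 ℕ.+ n) i * falling₂ n
        ∎
    where
    n : ℕ
    n = i ℕ.+ p
    I P w w′ : ℚ
    I = ℕtoℚ i
    P = ℕtoℚ p
    w = + 1 / suc (2 ℕ.* t)
    w′ = + 1 / suc (2 ℕ.+ 2 ℕ.* t)

    n∸2≡ : n ∸ 2 ≡ suc (2 ℕ.* t)
    n∸2≡ = cong (_∸ 2) n≡

    N[n] : ℕtoℚ n ≡ I + P
    N[n] = ℕtoℚ-homo-+ i p

    N[n∸2] : ℕtoℚ (n ∸ 2) ≡ I + P - ℕtoℚ 2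
    N[n∸2] = trans (ℕtoℚ-∸ (subst (2 ≤_) (sym n≡) (s≤s (s≤s z≤n)))) (cong (_- ℕtoℚ 2) N[n])

    inverse : ∀ d {k q} → k ≡ suc d → ℕtoℚ k ≡ q → q * (+ 1 / suc d) ≡ 1ℚ
    inverse d refl refl = ℕtoℚ-*-inverse d

    coefR-n : ∀ j → coefR n j ≡ (I + P - ℕtoℚ 2 - ℕtoℚ 2 * ℕtoℚ j) * w
    coefR-n j = trans (coefR-unfold n j n∸2≡) (cong (λ ν → (ν - ℕtoℚ 2 * ℕtoℚ j) * w) N[n∸2])

    coefR-n[p∸1] : - ℕtoℚ 2 * I * P * coefR n (p ∸ 1) ≡ - ℕtoℚ 2 * I * P * ((I + P - ℕtoℚ 2 - ℕtoℚ 2 * (P - 1ℚ)) * w)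
    coefR-n[p∸1] = *-cong-when-positive (- ℕtoℚ 2) i p λ _ 1≤p →
      trans (coefR-n (p ∸ 1)) (cong (λ q → (I + P - ℕtoℚ 2 - ℕtoℚ 2 * q) * w) (ℕtoℚ-∸ 1≤p))

    coefR-n[i∸2] : falling₂ i * coefR n (i ∸ 2) ≡ falling₂ i * ((I + P - ℕtoℚ 2 - ℕtoℚ 2 * (I - ℕtoℚ 2)) * w)
    coefR-n[i∸2] = falling₂-*-cong i λ 2≤i →
      trans (coefR-n (i ∸ 2)) (cong (λ q → (I + P - ℕtoℚ 2 - ℕtoℚ 2 * q) * w) (ℕtoℚ-∸ 2≤i))

    coefR-2+n : coefR (2 ℕ.+ n) i ≡ (I + P - ℕtoℚ 2 * I) * w′
    coefR-2+n = trans (coefR-unfold (2 ℕ.+ n) i n≡) (cong (λ ν → (ν - ℕtoℚ 2 * I) * w′) N[n])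

  linear-combination : ∀ κ₁ κ₂ κ₃ c₁ c₂ c₃ v₁ v₂ v₃ U →
      κ₁ * (- c₁ * U + v₁) + κ₂ * (- c₂ * U + v₂) + κ₃ * (- c₃ * U + v₃)
    ≡ - (κ₁ * c₁ + κ₂ * c₂ + κ₃ * c₃) * U + (κ₁ * v₁ + κ₂ * v₂ + κ₃ * v₃)
  linear-combination = solve-∀ ℚ-ring

  termR-guard-holds : ∀ {j n} → j ≤ n → ⌊ + 0 ℤ.≤? + j ⌋ ∧ ⌊ + j ℤ.≤? + n ⌋ ≡ true
  termR-guard-holds {j} {n} j≤n with + 0 ℤ.≤? + j | + j ℤ.≤? + n
  ... | yes _   | yes _   = refl
  ... | no 0≰j  | _       = contradiction (ℤ.+≤+ z≤n) 0≰j
  ... | yes _   | no j≰n  = contradiction (ℤ.+≤+ j≤n) j≰n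

  module Evaluation (x y : ℚ) where

    val val′ val″ : Poly → ℚ
    val p = ⟦ p ⟧ x y
    val′ p = ⟦ ∂y p ⟧ x y
    val″ p = ⟦ ∂y (∂y p) ⟧ x y

    val′-^^ : ∀ p a → val′ (p ^^ a) ≡ ℕtoℚ a * powℚ (val p) (a ∸ 1) * val′ p
    val′-^^ p zero    = vanish (val′ p)
      where
      vanish : ∀ d → 0ℚ ≡ 0ℚ * 1ℚ * d
      vanish = solve-∀ ℚ-ring
    val′-^^ p (suc a) = refl

    val″-^^ : ∀ p a → val″ p ≡ 0ℚ → val″ (p ^^ a) ≡ falling₂ a * powℚ (val p) (a ∸ 2) * (val′ p * val′ p)
    val″-^^ p zero    _    = vanish (val′ p)
      where
      vanish : ∀ d → 0ℚ ≡ 0ℚ * (0ℚ - 1ℚ) * 1ℚ * (d * d)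
      vanish = solve-∀ ℚ-ring
    val″-^^ p (suc a) p″≡0 = begin
      (0ℚ * powℚ v a + A * val′ (p ^^ a)) * val′ p + A * powℚ v a * val″ p
        ≡⟨ cong₂ (λ d e → (0ℚ * powℚ v a + A * d) * val′ p + A * powℚ v a * e) (val′-^^ p a) p″≡0 ⟩
      (0ℚ * powℚ v a + A * (ℕtoℚ a * powℚ v (a ∸ 1) * val′ p)) * val′ p + A * powℚ v a * 0ℚ
        ≡⟨ cong (λ a′ → (0ℚ * powℚ v a + A * (a′ * powℚ v (a ∸ 1) * val′ p)) * val′ p + A * powℚ v a * 0ℚ)
                (ℕtoℚ-∸ {suc a} {1} (s≤s z≤n)) ⟩
      (0ℚ * powℚ v a + A * ((A - 1ℚ) * powℚ v (a ∸ 1) * val′ p)) * val′ p + A * powℚ v a * 0ℚ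
        ≡⟨ regroup A (powℚ v a) (powℚ v (a ∸ 1)) (val′ p) ⟩
      A * (A - 1ℚ) * powℚ v (a ∸ 1) * (val′ p * val′ p)
        ∎
      where
      v A : ℚ
      v = val p
      A = ℕtoℚ (suc a)
      regroup : ∀ A q r d → (0ℚ * q + A * ((A - 1ℚ) * r * d)) * d + A * q * 0ℚ ≡ A * (A - 1ℚ) * r * (d * d)
      regroup = solve-∀ ℚ-ring

    val″-scaled : ∀ c p → val″ (con c ⊗ p) ≡ c * val″ p
    val″-scaled c p = expand c (val p) (val′ p) (val″ p)
      where
      expand : ∀ c a a′ a″ → (0ℚ * a + 0ℚ * a′) + (0ℚ * a′ + c * a″) ≡ c * a″
      expand = solve-∀ ℚ-ring

    val″-scaled-product : ∀ c p q →
      val″ (con c ⊗ p ⊗ q) ≡ c * (val″ p * val q + ℕtoℚ 2 * (val′ p * val′ q) + val p * val″ q)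
    val″-scaled-product c p q = expand c (val p) (val′ p) (val″ p) (val q) (val′ q) (val″ q)
      where
      expand : ∀ c a a′ a″ b b′ b″ →
          ((0ℚ * a + 0ℚ * a′) + (0ℚ * a′ + c * a″)) * b + (0ℚ * a + c * a′) * b′
        + ((0ℚ * a + c * a′) * b′ + c * a * b″)
        ≡ c * (a″ * b + ℕtoℚ 2 * (a′ * b′) + a * b″)
      expand = solve-∀ ℚ-ring

    S : Poly
    S = X ⊕ con (- 1ℚ) ⊗ Y

    u : ℚ
    u = val S

    val′-S : val′ S ≡ - 1ℚ
    val′-S = slope y
      where
      slope : ∀ y → 0ℚ + (0ℚ * y + - 1ℚ * 1ℚ) ≡ - 1ℚ
      slope = solve-∀ ℚ-ring

    val″-S : val″ S ≡ 0ℚ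
    val″-S = flat y
      where
      flat : ∀ y → 0ℚ + ((0ℚ * y + 0ℚ * 1ℚ) + (0ℚ * 1ℚ + - 1ℚ * 0ℚ)) ≡ 0ℚ
      flat = solve-∀ ℚ-ring

    val′-S^^ : ∀ a → val′ (S ^^ a) ≡ - (ℕtoℚ a * powℚ u (a ∸ 1))
    val′-S^^ a = trans (val′-^^ S a) (trans (cong (ℕtoℚ a * powℚ u (a ∸ 1) *_) val′-S) (times-minus-one _))
      where
      times-minus-one : ∀ q → q * - 1ℚ ≡ - q
      times-minus-one = solve-∀ ℚ-ring

    val″-S^^ : ∀ a → val″ (S ^^ a) ≡ falling₂ a * powℚ u (a ∸ 2)
    val″-S^^ a = trans (val″-^^ S a val″-S) (trans (cong (λ d → falling₂ a * powℚ u (a ∸ 2) * (d * d)) val′-S) (*-identityʳ _))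

    val′-Y^^ : ∀ a → val′ (Y ^^ a) ≡ ℕtoℚ a * powℚ y (a ∸ 1)
    val′-Y^^ a = trans (val′-^^ Y a) (*-identityʳ _)

    val″-Y^^ : ∀ a → val″ (Y ^^ a) ≡ falling₂ a * powℚ y (a ∸ 2)
    val″-Y^^ a = trans (val″-^^ Y a refl) (*-identityʳ _)

    mono : ℕ → ℕ → ℚ
    mono a b = powℚ u a * powℚ y b

    symMono : ℕ → ℕ → ℚ
    symMono a b = mono a b + mono b a

    symMono-comm : ∀ a b → symMono a b ≡ symMono b a
    symMono-comm a b = +-comm (mono a b) (mono b a)

    symMono″ : ℕ → ℕ → ℚ
    symMono″ a b = falling₂ a * symMono (a ∸ 2) b
                 - ℕtoℚ 2 * (ℕtoℚ a * ℕtoℚ b * symMono (a ∸ 1) (b ∸ 1))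
                 + falling₂ b * symMono a (b ∸ 2)

    val″-monomial : ∀ c a b → val″ (con c ⊗ S ^^ a ⊗ Y ^^ b) ≡
      c * (falling₂ a * mono (a ∸ 2) b - ℕtoℚ 2 * (ℕtoℚ a * ℕtoℚ b * mono (a ∸ 1) (b ∸ 1)) + falling₂ b * mono a (b ∸ 2))
    val″-monomial c a b = begin
      val″ (con c ⊗ S ^^ a ⊗ Y ^^ b)
        ≡⟨ val″-scaled-product c (S ^^ a) (Y ^^ b) ⟩
      c * (val″ (S ^^ a) * powℚ y b + ℕtoℚ 2 * (val′ (S ^^ a) * val′ (Y ^^ b)) + powℚ u a * val″ (Y ^^ b))
        ≡⟨ cong₂ (λ s″ s′ → c * (s″ * powℚ y b + ℕtoℚ 2 * (s′ * val′ (Y ^^ b)) + powℚ u a * val″ (Y ^^ b)))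
                 (val″-S^^ a) (val′-S^^ a) ⟩
      c * (falling₂ a * powℚ u (a ∸ 2) * powℚ y b + ℕtoℚ 2 * (- (ℕtoℚ a * powℚ u (a ∸ 1)) * val′ (Y ^^ b))
          + powℚ u a * val″ (Y ^^ b))
        ≡⟨ cong₂ (λ t′ t″ → c * (falling₂ a * powℚ u (a ∸ 2) * powℚ y b + ℕtoℚ 2 * (- (ℕtoℚ a * powℚ u (a ∸ 1)) * t′)
                                 + powℚ u a * t″))
                 (val′-Y^^ b) (val″-Y^^ b) ⟩
      c * (falling₂ a * powℚ u (a ∸ 2) * powℚ y b + ℕtoℚ 2 * (- (ℕtoℚ a * powℚ u (a ∸ 1)) * (ℕtoℚ b * powℚ y (b ∸ 1)))
          + powℚ u a * (falling₂ b * powℚ y (b ∸ 2)))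
        ≡⟨ regroup c (falling₂ a) (falling₂ b) (ℕtoℚ a) (ℕtoℚ b)
                   (powℚ u (a ∸ 2)) (powℚ u (a ∸ 1)) (powℚ u a) (powℚ y b) (powℚ y (b ∸ 1)) (powℚ y (b ∸ 2)) ⟩
      c * (falling₂ a * mono (a ∸ 2) b - ℕtoℚ 2 * (ℕtoℚ a * ℕtoℚ b * mono (a ∸ 1) (b ∸ 1)) + falling₂ b * mono a (b ∸ 2))
        ∎
      where
      regroup : ∀ c Fa Fb A B u₂ u₁ u₀ y₀ y₁ y₂ →
          c * (Fa * u₂ * y₀ + ℕtoℚ 2 * (- (A * u₁) * (B * y₁)) + u₀ * (Fb * y₂))
        ≡ c * (Fa * (u₂ * y₀) - ℕtoℚ 2 * (A * B * (u₁ * y₁)) + Fb * (u₀ * y₂))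
      regroup = solve-∀ ℚ-ring

    val-R : ∀ m j → val (atXminusY (R m j)) ≡
      - coefR m j * (powℚ u (m ∸ 2) + powℚ y (m ∸ 2)) + sgn j * symMono (m ∸ 2 ∸ j) j
    val-R m j = regroup (coefR m j) (sgn j) (powℚ u (m ∸ 2)) (powℚ y (m ∸ 2))
                        (powℚ u (m ∸ 2 ∸ j)) (powℚ y j) (powℚ u j) (powℚ y (m ∸ 2 ∸ j))
      where
      regroup : ∀ c s uₑ yₑ uₐ yⱼ uⱼ yₐ →
          - c * uₑ + s * uₐ * yⱼ + s * uⱼ * yₐ + - c * yₑ ≡ - c * (uₑ + yₑ) + s * (uₐ * yⱼ + uⱼ * yₐ)
      regroup = solve-∀ ℚ-ring

    val″-R : ∀ m j → val″ (atXminusY (R m j)) ≡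
      - (coefR m j * falling₂ (m ∸ 2)) * (powℚ u (m ∸ 2 ∸ 2) + powℚ y (m ∸ 2 ∸ 2)) + sgn j * symMono″ (m ∸ 2 ∸ j) j
    val″-R m j = begin
      val″ (con (- c) ⊗ S ^^ e) + val″ (con (sgn j) ⊗ S ^^ a ⊗ Y ^^ j)
        + val″ (con (sgn j) ⊗ S ^^ j ⊗ Y ^^ a) + val″ (con (- c) ⊗ Y ^^ e)
        ≡⟨ cong₂ _+_ (cong₂ _+_ (cong₂ _+_ (trans (val″-scaled (- c) (S ^^ e)) (cong (- c *_) (val″-S^^ e)))
                                           (val″-monomial (sgn j) a j))
                                (val″-monomial (sgn j) j a))
                     (trans (val″-scaled (- c) (Y ^^ e)) (cong (- c *_) (val″-Y^^ e))) ⟩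
      - c * (falling₂ e * powℚ u (e ∸ 2))
        + sgn j * (falling₂ a * mono (a ∸ 2) j - ℕtoℚ 2 * (ℕtoℚ a * ℕtoℚ j * mono (a ∸ 1) (j ∸ 1)) + falling₂ j * mono a (j ∸ 2))
        + sgn j * (falling₂ j * mono (j ∸ 2) a - ℕtoℚ 2 * (ℕtoℚ j * ℕtoℚ a * mono (j ∸ 1) (a ∸ 1)) + falling₂ a * mono j (a ∸ 2))
        + - c * (falling₂ e * powℚ y (e ∸ 2))
        ≡⟨ regroup c (falling₂ e) (powℚ u (e ∸ 2)) (powℚ y (e ∸ 2)) (sgn j) (falling₂ a) (falling₂ j) (ℕtoℚ a) (ℕtoℚ j)
                   (mono (a ∸ 2) j) (mono (a ∸ 1) (j ∸ 1)) (mono a (j ∸ 2))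
                   (mono (j ∸ 2) a) (mono (j ∸ 1) (a ∸ 1)) (mono j (a ∸ 2)) ⟩
      - (c * falling₂ e) * (powℚ u (e ∸ 2) + powℚ y (e ∸ 2)) + sgn j * symMono″ a j
        ∎
      where
      c : ℚ
      c = coefR m j
      e a : ℕ
      e = m ∸ 2
      a = e ∸ j
      regroup : ∀ c Fe uₑ yₑ s Fa Fj A J m₁ m₂ m₃ n₁ n₂ n₃ →
          - c * (Fe * uₑ)
        + s * (Fa * m₁ - ℕtoℚ 2 * (A * J * m₂) + Fj * m₃)
        + s * (Fj * n₁ - ℕtoℚ 2 * (J * A * n₂) + Fa * n₃)
        + - c * (Fe * yₑ)
        ≡ - (c * Fe) * (uₑ + yₑ)
        + s * (Fa * (m₁ + n₃) - ℕtoℚ 2 * (A * J * (m₂ + n₂)) + Fj * (m₃ + n₁))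
      regroup = solve-∀ ℚ-ring

    symMono″-recurrence : ∀ t i p → i ℕ.+ p ≡ 3 ℕ.+ 2 ℕ.* t →
        falling₂ p * (sgn i * symMono ((i ℕ.+ p) ∸ 2 ∸ i) i)
      + - ℕtoℚ 2 * ℕtoℚ i * ℕtoℚ p * (sgn (p ∸ 1) * symMono ((i ℕ.+ p) ∸ 2 ∸ (p ∸ 1)) (p ∸ 1))
      + falling₂ i * (sgn (i ∸ 2) * symMono ((i ℕ.+ p) ∸ 2 ∸ (i ∸ 2)) (i ∸ 2))
      ≡ sgn i * symMono″ p i
    symMono″-recurrence t i p n≡ = begin
        falling₂ p * (sgn i * symMono ((i ℕ.+ p) ∸ 2 ∸ i) i)
      + - ℕtoℚ 2 * ℕtoℚ i * ℕtoℚ p * (sgn (p ∸ 1) * symMono ((i ℕ.+ p) ∸ 2 ∸ (p ∸ 1)) (p ∸ 1))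
      + falling₂ i * (sgn (i ∸ 2) * symMono ((i ℕ.+ p) ∸ 2 ∸ (i ∸ 2)) (i ∸ 2))
        ≡⟨ cong₂ _+_ (cong₂ _+_ (cong (λ a → falling₂ p * (sgn i * symMono a i)) exponent-i)
                                (*-cong-when-positive (- ℕtoℚ 2) i p (shift-p∸1 i p n≡)))
                     (falling₂-*-cong i (shift-i∸2 i p)) ⟩
        falling₂ p * (sgn i * symMono (p ∸ 2) i)
      + - ℕtoℚ 2 * ℕtoℚ i * ℕtoℚ p * (sgn i * symMono (p ∸ 1) (i ∸ 1))
      + falling₂ i * (sgn i * symMono p (i ∸ 2))
        ≡⟨ factor-sign (falling₂ p) (falling₂ i) (ℕtoℚ i) (ℕtoℚ p) (sgn i)
                       (symMono (p ∸ 2) i) (symMono (p ∸ 1) (i ∸ 1)) (symMono p (i ∸ 2)) ⟩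
      sgn i * symMono″ p i
        ∎
      where
      exponent-i : (i ℕ.+ p) ∸ 2 ∸ i ≡ p ∸ 2
      exponent-i = begin
        (i ℕ.+ p) ∸ 2 ∸ i       ≡⟨ ℕ.∸-+-assoc (i ℕ.+ p) 2 i ⟩
        (i ℕ.+ p) ∸ (2 ℕ.+ i)   ≡⟨ cong ((i ℕ.+ p) ∸_) (ℕ.+-comm 2 i) ⟩
        (i ℕ.+ p) ∸ (i ℕ.+ 2)   ≡⟨ ℕ.[m+n]∸[m+o]≡n∸o i p 2 ⟩
        p ∸ 2                   ∎

      shift-p∸1 : ∀ i p → i ℕ.+ p ≡ 3 ℕ.+ 2 ℕ.* t → 1 ≤ i → 1 ≤ p →
        sgn (p ∸ 1) * symMono ((i ℕ.+ p) ∸ 2 ∸ (p ∸ 1)) (p ∸ 1) ≡ sgn i * symMono (p ∸ 1) (i ∸ 1)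
      shift-p∸1 (suc i) (suc p) n≡ _ _ = cong₂ _*_ (sym (sgn-even-sum (suc i) p (suc t) even))
                                                  (trans (cong (λ a → symMono a p) exponent) (symMono-comm i p))
        where
        even : suc i ℕ.+ p ≡ 2 ℕ.* suc t
        even = trans (sym (ℕ.+-suc i p)) (trans (ℕ.suc-injective n≡) (sym (ℕ.*-suc 2 t)))
        exponent : (suc i ℕ.+ suc p) ∸ 2 ∸ p ≡ i
        exponent = trans (cong (λ k → k ∸ 1 ∸ p) (ℕ.+-suc i p)) (ℕ.m+n∸n≡m i p)

      shift-i∸2 : ∀ i p → 2 ≤ i →
        sgn (i ∸ 2) * symMono ((i ℕ.+ p) ∸ 2 ∸ (i ∸ 2)) (i ∸ 2) ≡ sgn i * symMono p (i ∸ 2)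
      shift-i∸2 (suc zero)    p (s≤s ())
      shift-i∸2 (suc (suc r)) p _ = cong₂ _*_ (sym (sgn-2+ r)) (cong (λ a → symMono a r) (ℕ.m+n∸m≡n r p))

      factor-sign : ∀ Fp Fi I P s A₁ A₂ A₃ →
          Fp * (s * A₁) + - ℕtoℚ 2 * I * P * (s * A₂) + Fi * (s * A₃)
        ≡ s * (Fp * A₁ - ℕtoℚ 2 * (P * I * A₂) + Fi * A₃)
      factor-sign = solve-∀ ℚ-ring

    val″-R-recurrence : ∀ t i p → i ℕ.+ p ≡ 3 ℕ.+ 2 ℕ.* t →
        val″ (atXminusY (R (2 ℕ.+ (i ℕ.+ p)) i))
      ≡ falling₂ p * val (atXminusY (R (i ℕ.+ p) i))
      + - ℕtoℚ 2 * ℕtoℚ i * ℕtoℚ p * val (atXminusY (R (i ℕ.+ p) (p ∸ 1)))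
      + falling₂ i * val (atXminusY (R (i ℕ.+ p) (i ∸ 2)))
    val″-R-recurrence t i p n≡ = begin
      val″ (atXminusY (R (2 ℕ.+ n) i))
        ≡⟨ val″-R (2 ℕ.+ n) i ⟩
      - (coefR (2 ℕ.+ n) i * falling₂ n) * U + sgn i * symMono″ (n ∸ i) i
        ≡⟨ cong₂ (λ c a → - c * U + sgn i * symMono″ a i) (sym (coefR-recurrence t i p n≡)) (ℕ.m+n∸m≡n i p) ⟩
      - (κ₁ * c₁ + κ₂ * c₂ + κ₃ * c₃) * U + sgn i * symMono″ p i
        ≡⟨ cong (λ v → - (κ₁ * c₁ + κ₂ * c₂ + κ₃ * c₃) * U + v) (sym (symMono″-recurrence t i p n≡)) ⟩
      - (κ₁ * c₁ + κ₂ * c₂ + κ₃ * c₃) * U + (κ₁ * v₁ + κ₂ * v₂ + κ₃ * v₃)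
        ≡⟨ linear-combination κ₁ κ₂ κ₃ c₁ c₂ c₃ v₁ v₂ v₃ U ⟨
      κ₁ * (- c₁ * U + v₁) + κ₂ * (- c₂ * U + v₂) + κ₃ * (- c₃ * U + v₃)
        ≡⟨ cong₂ _+_ (cong₂ _+_ (cong (κ₁ *_) (val-R n i)) (cong (κ₂ *_) (val-R n (p ∸ 1))))
                     (cong (κ₃ *_) (val-R n (i ∸ 2))) ⟨
      κ₁ * val (atXminusY (R n i)) + κ₂ * val (atXminusY (R n (p ∸ 1))) + κ₃ * val (atXminusY (R n (i ∸ 2)))
        ∎
      where
      n : ℕ
      n = i ℕ.+ p
      U κ₁ κ₂ κ₃ c₁ c₂ c₃ v₁ v₂ v₃ : ℚ
      U = powℚ u (n ∸ 2) + powℚ y (n ∸ 2)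
      κ₁ = falling₂ p
      κ₂ = - ℕtoℚ 2 * ℕtoℚ i * ℕtoℚ p
      κ₃ = falling₂ i
      c₁ = coefR n i
      c₂ = coefR n (p ∸ 1)
      c₃ = coefR n (i ∸ 2)
      v₁ = sgn i * symMono (n ∸ 2 ∸ i) i
      v₂ = sgn (p ∸ 1) * symMono (n ∸ 2 ∸ (p ∸ 1)) (p ∸ 1)
      v₃ = sgn (i ∸ 2) * symMono (n ∸ 2 ∸ (i ∸ 2)) (i ∸ 2)

    val-termR : ∀ c m j j′ → c ≡ + 0 ⊎ (j ≡ + j′ × j′ ≤ m ∸ 2) →
      ⟦ termR c m j ⟧ x y ≡ ℤtoℚ c * val (atXminusY (R m j′))
    val-termR .(+ 0) m j j′ (inj₁ refl) with ⌊ + 0 ℤ.≤? j ⌋ ∧ ⌊ j ℤ.≤? + (m ∸ 2) ⌋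
    ... | true  = trans (*-zeroˡ (val (atXminusY (R m ℤ.∣ j ∣)))) (sym (*-zeroˡ (val (atXminusY (R m j′)))))
    ... | false = sym (*-zeroˡ (val (atXminusY (R m j′))))
    val-termR c m .(+ j′) j′ (inj₂ (refl , j′≤m∸2))
      with ⌊ + 0 ℤ.≤? + j′ ⌋ ∧ ⌊ + j′ ℤ.≤? + (m ∸ 2) ⌋ | termR-guard-holds j′≤m∸2
    ... | .true | refl = refl

    val-termR-i : ∀ i p →
      ⟦ termR (+ p ℤ.* (+ p ℤ.- + 1)) (i ℕ.+ p) (+ i) ⟧ x y ≡ falling₂ p * val (atXminusY (R (i ℕ.+ p) i))
    val-termR-i i p = trans (val-termR _ (i ℕ.+ p) (+ i) i (vanishes-or-in-range p))
                            (cong (_* val (atXminusY (R (i ℕ.+ p) i))) (ℤtoℚ-falling₂ p))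
      where
      vanishes-or-in-range : ∀ p → + p ℤ.* (+ p ℤ.- + 1) ≡ + 0 ⊎ (+ i ≡ + i × i ≤ (i ℕ.+ p) ∸ 2)
      vanishes-or-in-range zero          = inj₁ refl
      vanishes-or-in-range (suc zero)    = inj₁ refl
      vanishes-or-in-range (suc (suc r)) = inj₂ (refl , subst (i ≤_) (sym (ℕ.+-∸-assoc i (s≤s (s≤s z≤n)))) (ℕ.m≤m+n i r))

    val-termR-p∸1 : ∀ i p →
      ⟦ termR (ℤ.- (+ 2 ℤ.* + i ℤ.* + p)) (i ℕ.+ p) (+ p ℤ.- + 1) ⟧ x y
        ≡ - ℕtoℚ 2 * ℕtoℚ i * ℕtoℚ p * val (atXminusY (R (i ℕ.+ p) (p ∸ 1)))
    val-termR-p∸1 i p = trans (val-termR _ (i ℕ.+ p) (+ p ℤ.- + 1) (p ∸ 1) (vanishes-or-in-range i p))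
                              (cong (_* val (atXminusY (R (i ℕ.+ p) (p ∸ 1)))) cast)
      where
      vanishes-or-in-range : ∀ i p →
        ℤ.- (+ 2 ℤ.* + i ℤ.* + p) ≡ + 0 ⊎ (+ p ℤ.- + 1 ≡ + (p ∸ 1) × p ∸ 1 ≤ (i ℕ.+ p) ∸ 2)
      vanishes-or-in-range zero    p       = inj₁ refl
      vanishes-or-in-range (suc i) zero    = inj₁ (cong ℤ.-_ (ℤ.*-zeroʳ (+ 2 ℤ.* + suc i)))
      vanishes-or-in-range (suc i) (suc p) = inj₂ (refl , subst (p ≤_) (sym (ℕ.+-∸-assoc i (s≤s z≤n))) (ℕ.m≤n+m p i))
      cast : ℤtoℚ (ℤ.- (+ 2 ℤ.* + i ℤ.* + p)) ≡ - ℕtoℚ 2 * ℕtoℚ i * ℕtoℚ p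
      cast = begin
        ℤtoℚ (ℤ.- (+ 2 ℤ.* + i ℤ.* + p))      ≡⟨ ℤtoℚ-homo‿- (+ 2 ℤ.* + i ℤ.* + p) ⟩
        - ℤtoℚ (+ 2 ℤ.* + i ℤ.* + p)          ≡⟨ cong -_ (trans (ℤtoℚ-homo-* (+ 2 ℤ.* + i) (+ p)) (cong (_* ℕtoℚ p) (ℤtoℚ-homo-* (+ 2) (+ i)))) ⟩
        - (ℕtoℚ 2 * ℕtoℚ i * ℕtoℚ p)          ≡⟨ neg-distribˡ-* (ℕtoℚ 2 * ℕtoℚ i) (ℕtoℚ p) ⟩
        - (ℕtoℚ 2 * ℕtoℚ i) * ℕtoℚ p          ≡⟨ cong (_* ℕtoℚ p) (neg-distribˡ-* (ℕtoℚ 2) (ℕtoℚ i)) ⟩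
        - ℕtoℚ 2 * ℕtoℚ i * ℕtoℚ p            ∎

    val-termR-i∸2 : ∀ i p →
      ⟦ termR (+ i ℤ.* (+ i ℤ.- + 1)) (i ℕ.+ p) (+ i ℤ.- + 2) ⟧ x y ≡ falling₂ i * val (atXminusY (R (i ℕ.+ p) (i ∸ 2)))
    val-termR-i∸2 i p = trans (val-termR _ (i ℕ.+ p) (+ i ℤ.- + 2) (i ∸ 2) (vanishes-or-in-range i))
                              (cong (_* val (atXminusY (R (i ℕ.+ p) (i ∸ 2)))) (ℤtoℚ-falling₂ i))
      where
      vanishes-or-in-range : ∀ i → + i ℤ.* (+ i ℤ.- + 1) ≡ + 0 ⊎ (+ i ℤ.- + 2 ≡ + (i ∸ 2) × i ∸ 2 ≤ (i ℕ.+ p) ∸ 2)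
      vanishes-or-in-range zero          = inj₁ refl
      vanishes-or-in-range (suc zero)    = inj₁ refl
      vanishes-or-in-range (suc (suc r)) = inj₂ (refl , ℕ.m≤m+n r p)

  second-derivative-R : ∀ t i p → i ℕ.+ p ≡ 3 ℕ.+ 2 ℕ.* t →
    ∂y (∂y (atXminusY (R (2 ℕ.+ (i ℕ.+ p)) i))) ≈ₚ ∂²R-expansion (2 ℕ.+ (i ℕ.+ p)) i
  second-derivative-R t i p n≡ x y = begin
    val″ (atXminusY (R (2 ℕ.+ n) i))
      ≡⟨ val″-R-recurrence t i p n≡ ⟩
    falling₂ p * val (atXminusY (R n i))
      + - ℕtoℚ 2 * ℕtoℚ i * ℕtoℚ p * val (atXminusY (R n (p ∸ 1)))
      + falling₂ i * val (atXminusY (R n (i ∸ 2)))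
      ≡⟨ cong₂ _+_ (cong₂ _+_ (val-termR-i i p) (val-termR-p∸1 i p)) (val-termR-i∸2 i p) ⟨
    ⟦ termR (+ p ℤ.* (+ p ℤ.- + 1)) n (+ i)
      ⊕ termR (ℤ.- (+ 2 ℤ.* + i ℤ.* + p)) n (+ p ℤ.- + 1)
      ⊕ termR (+ i ℤ.* (+ i ℤ.- + 1)) n (+ i ℤ.- + 2) ⟧ x y
      ≡⟨ cong₂ (λ a b → ⟦ termR (a ℤ.* b) n (+ i) ⊕ termR (ℤ.- (+ 2 ℤ.* + i ℤ.* a)) n b
                           ⊕ termR (+ i ℤ.* (+ i ℤ.- + 1)) n (+ i ℤ.- + 2) ⟧ x y)
               (sym (k-2-i (+ i) (+ p))) (sym (k-3-i (+ i) (+ p))) ⟩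
    ⟦ ∂²R-expansion (2 ℕ.+ n) i ⟧ x y
      ∎
    where
    open Evaluation x y
    n : ℕ
    n = i ℕ.+ p
    k-2-i : ∀ a b → + 2 ℤ.+ (a ℤ.+ b) ℤ.- + 2 ℤ.- a ≡ b
    k-2-i = solveℤ
    k-3-i : ∀ a b → + 2 ℤ.+ (a ℤ.+ b) ℤ.- + 3 ℤ.- a ≡ b ℤ.- + 1
    k-3-i = solveℤ

open import Data.Nat using (_+_; _*_)

lemma3 : (K : ℕ) → 2 ≤ K → (i : ℕ) → i ≤ (2 * K + 1) ∸ 2 →
    ∂y (∂y (atXminusY (R (2 * K + 1) i)))
      ≈ₚ
    ( termR ((+ (2 * K + 1) ℤ.- + 2 ℤ.- + i) ℤ.* (+ (2 * K + 1) ℤ.- + 3 ℤ.- + i))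
            ((2 * K + 1) ∸ 2) (+ i)
    ⊕ termR (ℤ.- (+ 2 ℤ.* + i ℤ.* (+ (2 * K + 1) ℤ.- + 2 ℤ.- + i)))
            ((2 * K + 1) ∸ 2) (+ (2 * K + 1) ℤ.- + 3 ℤ.- + i)
    ⊕ termR (+ i ℤ.* (+ i ℤ.- + 1))
            ((2 * K + 1) ∸ 2) (+ i ℤ.- + 2) )
lemma3 (suc zero)    (s≤s ()) _
lemma3 (suc (suc t)) _ i i≤k∸2 =
  subst (λ k → ∂y (∂y (atXminusY (R k i))) ≈ₚ ∂²R-expansion k i)
        (cong (λ n → 2 + n) i+p≡k∸2)
        (second-derivative-R t i p (trans i+p≡k∸2 (cong (_∸ 2) (k≡ t))))
  where
  p : ℕ
  p = (2 * suc (suc t) + 1) ∸ 2 ∸ i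
  i+p≡k∸2 : i + p ≡ (2 * suc (suc t) + 1) ∸ 2
  i+p≡k∸2 = ℕ.m+[n∸m]≡n i≤k∸2
  k≡ : ∀ t → 2 * suc (suc t) + 1 ≡ 2 + (3 + 2 * t)
  k≡ = solveℕ
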